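{- Fix an integer $\ell\ge3$. For $n\ge4$ let $v_{n,\ell}$ be the number of coherent lattice paths of size $n$ and length $\ell$. Then there is a polynomial $p_\ell$ of degree $\ell-3$ such that $v_{n,\ell}=p_\ell(n)$ for all $n\ge\max\bigl(4,\left\lceil\tfrac23\ell+1\right\rceil\bigr)$.
   Context: A diagonal-avoiding lattice path of size $n$ (dimension 2) is a sequence of points $\boldsymbol\ell_1,\dots,\boldsymbol\ell_r\in[n]^2$ with $\boldsymbol\ell_1=(2,1)$, $\boldsymbol\ell_r\in\{(n-1,n),(n,n-1)\}$, the two coordinates of each point distinct, and consecutive points differing in exactly one coordinate, which strictly increases; its length is $r$ (the number of points). Its $i$-th enhanced step is $(a\to b;z)$ where the changing coordinate goes from $a$ to $b$ and the fixed coordinate equals $z$; $\prec$ denotes the order of steps along the path. It is a coherent lattice path if for all enhanced steps $(i\to j;a)\prec(x\to y;z)$ with $x<j$ one has $j=z$ or $x=a$. -}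

module Defs where

open import Data.Nat using (ℕ; zero; suc; _+_; _*_; _∸_; _≤_; _<_; _≟_; _≤?_; _<?_; _≡ᵇ_)
open import Data.Nat.DivMod using (_/_)
open import Data.Bool using (if_then_else_)
open import Data.Product using (_×_; _,_; Σ; ∃)
open import Data.Product.Properties using () renaming (≡-dec to ×-≡-dec)
open import Data.Sum using (_⊎_)
open import Data.Maybe using (Maybe; just; nothing)
open import Data.Maybe.Properties using () renaming (≡-dec to maybe-≡-dec)
open import Data.List using (List; []; _∷_; map; concatMap; filter; length; cartesianProduct; upTo; head; last; _∷ʳ_)
open import Data.List.Relation.Unary.All using (All; all?)
open import Data.List.Relation.Unary.Linked using (Linked; linked?)
open import Data.Integer using (+_)
open import Data.Rational using (ℚ; 0ℚ) renaming (_/_ to _/ℚ_;  _+_ to _+ℚ_; _*_ to _*ℚ_)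
open import Relation.Nullary using (¬_; Dec; yes; no; _×-dec_; _⊎-dec_; _→-dec_; ¬?)
open import Relation.Binary.PropositionalEquality using (_≡_)

Point : Set
Point = ℕ × ℕ

GoodPoint : ℕ → Point → Set
GoodPoint n (x , y) = (1 ≤ x × x ≤ n) × (1 ≤ y × y ≤ n) × ¬ (x ≡ y)

Step : Point → Point → Set
Step (x₁ , y₁) (x₂ , y₂) = (x₁ ≡ x₂ × y₁ < y₂) ⊎ (y₁ ≡ y₂ × x₁ < x₂)

-- A diagonal-avoiding lattice path of size n, given as its list of points ℓ₁,…,ℓ_r
-- (its length is the length r of the list).
IsLatticePath : ℕ → List Point → Set
IsLatticePath n ps =
  (head ps ≡ just (2 , 1)) ×
  ((last ps ≡ just (n ∸ 1 , n)) ⊎ (last ps ≡ just (n , n ∸ 1))) ×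
  All (GoodPoint n) ps ×
  Linked Step ps

-- Enhanced step (a → b ; z) encoded as the triple (a , b , z).
EStep : Set
EStep = ℕ × ℕ × ℕ

enhanced : Point → Point → EStep
enhanced (x₁ , y₁) (x₂ , y₂) =
  if x₁ ≡ᵇ x₂ then (y₁ , y₂ , x₁) else (x₁ , x₂ , y₁)

enhancedSteps : List Point → List EStep
enhancedSteps []             = []
enhancedSteps (p ∷ [])       = []
enhancedSteps (p ∷ q ∷ ps)   = enhanced p q ∷ enhancedSteps (q ∷ ps)

Compatible : EStep → EStep → Set
Compatible (i , j , a) (x , y , z) = x < j → (j ≡ z ⊎ x ≡ a)

AllPairs : List EStep → Set
AllPairs []       = Data.Unit.⊤
  where import Data.Unit
AllPairs (s ∷ ss) = All (Compatible s) ss × AllPairs ss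

IsCoherentLatticePath : ℕ → List Point → Set
IsCoherentLatticePath n ps = IsLatticePath n ps × AllPairs (enhancedSteps ps)

goodPoint? : ∀ n p → Dec (GoodPoint n p)
goodPoint? n (x , y) = ((1 ≤? x) ×-dec (x ≤? n)) ×-dec ((1 ≤? y) ×-dec (y ≤? n)) ×-dec ¬? (x ≟ y)

step? : ∀ p q → Dec (Step p q)
step? (x₁ , y₁) (x₂ , y₂) = ((x₁ ≟ x₂) ×-dec (y₁ <? y₂)) ⊎-dec ((y₁ ≟ y₂) ×-dec (x₁ <? x₂))

private
  point-≟ : (p q : Point) → Dec (p ≡ q)
  point-≟ = ×-≡-dec _≟_ _≟_

  mpoint-≟ : (p q : Maybe Point) → Dec (p ≡ q)
  mpoint-≟ = maybe-≡-dec point-≟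

compatible? : ∀ s t → Dec (Compatible s t)
compatible? (i , j , a) (x , y , z) = (x <? j) →-dec ((j ≟ z) ⊎-dec (x ≟ a))

allPairs? : ∀ ss → Dec (AllPairs ss)
allPairs? []       = yes _
allPairs? (s ∷ ss) = all? (compatible? s) ss ×-dec allPairs? ss

isLatticePath? : ∀ n ps → Dec (IsLatticePath n ps)
isLatticePath? n ps =
  mpoint-≟ (head ps) (just (2 , 1)) ×-dec
  (mpoint-≟ (last ps) (just (n ∸ 1 , n)) ⊎-dec mpoint-≟ (last ps) (just (n , n ∸ 1))) ×-dec
  all? (goodPoint? n) ps ×-dec
  linked? step? ps

isCoherentLatticePath? : ∀ n ps → Dec (IsCoherentLatticePath n ps)
isCoherentLatticePath? n ps = isLatticePath? n ps ×-dec allPairs? (enhancedSteps ps)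

grid : ℕ → List Point
grid n = cartesianProduct (map suc (upTo n)) (map suc (upTo n))

tuples : {A : Set} → ℕ → List A → List (List A)
tuples zero    xs = [] ∷ []
tuples (suc r) xs = concatMap (λ x → map (x ∷_) (tuples r xs)) xs

v : ℕ → ℕ → ℕ
v n ℓ = length (filter (isCoherentLatticePath? n) (tuples ℓ (grid n)))

-- Polynomials over ℚ as coefficient lists [c₀, c₁, …, c_d] (constant term first)

eval : List ℚ → ℚ → ℚ
eval []       x = 0ℚ
eval (c ∷ cs) x = c +ℚ (x *ℚ eval cs x)

HasDegree : List ℚ → ℕ → Set
HasDegree cs d = Σ (List ℚ) λ cs′ → Σ ℚ λ c → (cs ≡ cs′ ∷ʳ c) × ¬ (c ≡ 0ℚ) × (length cs′ ≡ d)

ℕ→ℚ : ℕ → ℚ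
ℕ→ℚ n = (+ n) /ℚ 1

⌈_/3⌉ : ℕ → ℕ
⌈ m /3⌉ = (m + 2) / 3

-- Let c ℓ j n count the coherent paths of size n and length ℓ that visit each of the values
-- 3, …, j + 2 (as a coordinate of some point).  Coherence only compares coordinates, so it is
-- invariant under any order-preserving relabelling of the values.  Deleting an unvisited value
-- u = j + 3 and closing the gap is therefore a bijection, which splits the paths of size n + 1
-- according to whether they visit u:  c ℓ j (n + 1) = c ℓ j n + c ℓ (j + 1) (n + 1)  for n ≥ j + 4.
-- A path of length ℓ takes at most ℓ + 1 values, so c ℓ j (j + 4) = 0 once j > ℓ − 3, while the
-- hook (2,1), (3,1), …, (ℓ,1), (ℓ,ℓ+1) shows c ℓ (ℓ − 3) (ℓ + 1) > 0.  Solving the recurrence gives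
-- v n ℓ = c ℓ 0 n = Σ_{k ≤ ℓ−3} C(n − 4, k) · c ℓ k (k + 4), a polynomial in n of degree exactly ℓ − 3:
-- in Horner form a₀ + (n − 4)/1 · (a₁ + (n − 5)/2 · (⋯)) its leading coefficient is a_{ℓ−3}/(ℓ − 3)! ≠ 0.

module Submission where

open import Defs
open import Data.Nat using (ℕ; _≤_; _+_; _*_; _∸_; _⊔_)
open import Data.Product using (Σ; _×_)
open import Data.List using (List)
open import Data.Rational using (ℚ)
open import Relation.Binary.PropositionalEquality using (_≡_)

open import Data.Bool using (true; false)
open import Data.Bool.Properties using (T-≡)
import Data.Integer as ℤ
import Data.Integer.Properties as ℤ
open import Data.List using ([]; _∷_; _∷ʳ_; _++_; map; filter; length; concatMap; cartesianProduct; upTo; last)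
open import Data.List.Membership.Propositional using (_∈_; lose)
open import Data.List.Membership.Propositional.Properties
  using (∈-map⁺; ∈-map⁻; ∈-upTo⁺; ∈-upTo⁻; ∈-concat⁺′; ∈-cartesianProduct⁺;
         ∈-∃++; ∈-++⁻; ∈-++⁺ˡ; ∈-++⁺ʳ)
open import Data.List.Properties
  using (filter-++; filter-≐; filter-none; filter-all; filter-some; filter-accept; filter-reject; head-map; last-map;
         ++-identityʳ; map-++; map-∘; map-id-local; length-map; length-upTo; length-++-sucʳ; upTo-∷ʳ;
         concatMap-map; map-concatMap; concatMap-cong)
open import Data.List.Relation.Unary.All as All using (All; []; _∷_; all?)
import Data.List.Relation.Unary.All.Properties as All
open import Data.List.Relation.Unary.Any as Any using (Any; here; there; any?)
import Data.List.Relation.Unary.Any.Properties as Any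
import Data.List.Relation.Unary.AllPairs as AllPairs
open import Data.List.Relation.Unary.Linked as Linked using (Linked; []; [-]; _∷_)
import Data.List.Relation.Unary.Linked.Properties as Linked
open import Data.List.Relation.Unary.Unique.Propositional using (Unique)
import Data.List.Relation.Unary.Unique.Propositional.Properties as Unique
open import Data.Maybe as Maybe using (just)
import Data.Maybe.Properties as Maybe
open import Data.Nat using (zero; suc; _<_; _≟_; _<?_; _≡ᵇ_; s≤s; z≤n)
open import Data.Nat.Combinatorics using (_C_; nC1≡n; nCk+nC[k+1]≡[n+1]C[k+1])
import Data.Nat.Coprimality as Coprimality
import Data.Nat.Properties as ℕ
open import Algebra.Properties.CommutativeSemigroup ℕ.+-commutativeSemigroup using () renaming (interchange to +-interchange)
open import Data.Nat.Solver using () renaming (module +-*-Solver to ℕ-Solver)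
open import Data.Product as Product using (_,_; proj₁; proj₂)
open import Data.Product.Function.NonDependent.Propositional using (_×-⇔_)
open import Data.Rational using (0ℚ; 1ℚ; mkℚ; -_; 1/_; ≢-nonZero) renaming (_+_ to _+ℚ_; _*_ to _*ℚ_)
open import Data.Rational.Properties
  using (1≢0; normalize-coprime; toℚᵘ-injective; toℚᵘ-homo-+; +-identityˡ; +-identityʳ; +-assoc;
         *-zeroˡ; *-zeroʳ; *-identityˡ; *-assoc; *-inverseˡ; *-inverseʳ)
open import Data.Rational.Solver using () renaming (module +-*-Solver to ℚ-Solver)
import Data.Rational.Unnormalised as ℚᵘ
import Data.Rational.Unnormalised.Properties as ℚᵘ
open import Data.Sum using (_⊎_; inj₁; inj₂; [_,_]; [_,_]′)
open import Data.Sum.Function.Propositional using (_⊎-⇔_)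
open import Data.Unit using (⊤; tt)
open import Function using (_∘_; id)
open import Function.Bundles using (_⇔_; mk⇔; Equivalence)
open import Function.Related.TypeIsomorphisms using (→-cong-⇔; ¬-cong-⇔)
open import Relation.Binary using (tri<; tri≈; tri>)
open import Relation.Binary.PropositionalEquality
  using (_≢_; refl; sym; trans; cong; cong₂; subst; subst₂; module ≡-Reasoning)
open import Relation.Nullary using (yes; no; ¬_; _×-dec_; _⊎-dec_; ¬?; contradiction)
open import Relation.Unary using (Decidable)
open import Relation.Unary.Properties using (_∩?_; ∁?)
open ≡-Reasoning

-- Rational polynomials

coprimeTo1 : ∀ n → Coprimality.Coprime n 1
coprimeTo1 n = Coprimality.sym (Coprimality.1-coprimeTo n)

ℕ→ℚ≡mkℚ : ∀ n → ℕ→ℚ n ≡ mkℚ (ℤ.+ n) 0 (coprimeTo1 n)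
ℕ→ℚ≡mkℚ n = normalize-coprime (coprimeTo1 n)

ℕ→ℚ-suc : ∀ n → ℕ→ℚ (suc n) ≡ 1ℚ +ℚ ℕ→ℚ n
ℕ→ℚ-suc n rewrite ℕ→ℚ≡mkℚ n | ℕ→ℚ≡mkℚ (suc n) =
  toℚᵘ-injective (ℚᵘ.≃-trans (ℚᵘ.*≡* integer-identity)
                               (ℚᵘ.≃-sym (toℚᵘ-homo-+ 1ℚ (mkℚ (ℤ.+ n) 0 (coprimeTo1 n)))))
  where
  integer-identity : ℤ.+ suc n ℤ.* ℤ.+ 1 ≡ (ℤ.+ 1 ℤ.+ ℤ.+ n ℤ.* ℤ.+ 1) ℤ.* ℤ.+ 1
  integer-identity = cong (λ t → (ℤ.+ 1 ℤ.+ t) ℤ.* ℤ.+ 1) (sym (ℤ.*-identityʳ (ℤ.+ n)))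

ℕ→ℚ-+ : ∀ m n → ℕ→ℚ (m + n) ≡ ℕ→ℚ m +ℚ ℕ→ℚ n
ℕ→ℚ-+ zero    n = sym (+-identityˡ (ℕ→ℚ n))
ℕ→ℚ-+ (suc m) n = begin
  ℕ→ℚ (suc (m + n))          ≡⟨ ℕ→ℚ-suc (m + n) ⟩
  1ℚ +ℚ ℕ→ℚ (m + n)          ≡⟨ cong (1ℚ +ℚ_) (ℕ→ℚ-+ m n) ⟩
  1ℚ +ℚ (ℕ→ℚ m +ℚ ℕ→ℚ n)     ≡⟨ +-assoc 1ℚ (ℕ→ℚ m) (ℕ→ℚ n) ⟨
  (1ℚ +ℚ ℕ→ℚ m) +ℚ ℕ→ℚ n     ≡⟨ cong (_+ℚ ℕ→ℚ n) (ℕ→ℚ-suc m) ⟨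
  ℕ→ℚ (suc m) +ℚ ℕ→ℚ n       ∎

ℕ→ℚ-* : ∀ m n → ℕ→ℚ (m * n) ≡ ℕ→ℚ m *ℚ ℕ→ℚ n
ℕ→ℚ-* zero    n = sym (*-zeroˡ (ℕ→ℚ n))
ℕ→ℚ-* (suc m) n = begin
  ℕ→ℚ (n + m * n)            ≡⟨ ℕ→ℚ-+ n (m * n) ⟩
  ℕ→ℚ n +ℚ ℕ→ℚ (m * n)       ≡⟨ cong (ℕ→ℚ n +ℚ_) (ℕ→ℚ-* m n) ⟩
  ℕ→ℚ n +ℚ ℕ→ℚ m *ℚ ℕ→ℚ n    ≡⟨ solve 2 (λ x y → y :+ x :* y := (con 1ℚ :+ x) :* y) refl (ℕ→ℚ m) (ℕ→ℚ n) ⟩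
  (1ℚ +ℚ ℕ→ℚ m) *ℚ ℕ→ℚ n     ≡⟨ cong (_*ℚ ℕ→ℚ n) (ℕ→ℚ-suc m) ⟨
  ℕ→ℚ (suc m) *ℚ ℕ→ℚ n       ∎
  where open ℚ-Solver

ℕ→ℚ-suc≢0 : ∀ n → ℕ→ℚ (suc n) ≢ 0ℚ
ℕ→ℚ-suc≢0 n eq with () ← trans (sym (ℕ→ℚ≡mkℚ (suc n))) eq

ℕ→ℚ-≢0 : ∀ {n} → n ≢ 0 → ℕ→ℚ n ≢ 0ℚ
ℕ→ℚ-≢0 {zero}  n≢0 = λ _ → n≢0 refl
ℕ→ℚ-≢0 {suc n} _   = ℕ→ℚ-suc≢0 n

*-≢0 : ∀ {p q} → p ≢ 0ℚ → q ≢ 0ℚ → p *ℚ q ≢ 0ℚ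
*-≢0 {p} {q} p≢0 q≢0 pq≡0 = q≢0 (begin
  q                   ≡⟨ *-identityˡ q ⟨
  1ℚ *ℚ q             ≡⟨ cong (_*ℚ q) (*-inverseˡ p) ⟨
  (1/ p *ℚ p) *ℚ q    ≡⟨ *-assoc (1/ p) p q ⟩
  1/ p *ℚ (p *ℚ q)    ≡⟨ cong (1/ p *ℚ_) pq≡0 ⟩
  1/ p *ℚ 0ℚ          ≡⟨ *-zeroʳ (1/ p) ⟩
  0ℚ                  ∎)
  where instance _ = ≢-nonZero p≢0

recip : ℕ → ℚ
recip i = 1/ ℕ→ℚ (suc i)
  where instance _ = ≢-nonZero (ℕ→ℚ-suc≢0 i)

recip-inverse : ∀ i → ℕ→ℚ (suc i) *ℚ recip i ≡ 1ℚ
recip-inverse i = *-inverseʳ (ℕ→ℚ (suc i))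
  where instance _ = ≢-nonZero (ℕ→ℚ-suc≢0 i)

recip≢0 : ∀ i → recip i ≢ 0ℚ
recip≢0 i r≡0 = 1≢0 (begin
  1ℚ                       ≡⟨ recip-inverse i ⟨
  ℕ→ℚ (suc i) *ℚ recip i   ≡⟨ cong (ℕ→ℚ (suc i) *ℚ_) r≡0 ⟩
  ℕ→ℚ (suc i) *ℚ 0ℚ        ≡⟨ *-zeroʳ (ℕ→ℚ (suc i)) ⟩
  0ℚ                       ∎)

addConst : ℚ → List ℚ → List ℚ
addConst a []       = a ∷ []
addConst a (c ∷ cs) = a +ℚ c ∷ cs

mulLinear : ℚ → ℚ → List ℚ → List ℚ
mulLinear α β []       = []
mulLinear α β (c ∷ cs) = β *ℚ c ∷ addConst (α *ℚ c) (mulLinear α β cs)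

eval-addConst : ∀ a p x → eval (addConst a p) x ≡ a +ℚ eval p x
eval-addConst a []       x = cong (a +ℚ_) (*-zeroʳ x)
eval-addConst a (c ∷ cs) x = +-assoc a c (x *ℚ eval cs x)

eval-mulLinear : ∀ α β p x → eval (mulLinear α β p) x ≡ (α *ℚ x +ℚ β) *ℚ eval p x
eval-mulLinear α β []       x = sym (*-zeroʳ (α *ℚ x +ℚ β))
eval-mulLinear α β (c ∷ cs) x = begin
  β *ℚ c +ℚ x *ℚ eval (addConst (α *ℚ c) (mulLinear α β cs)) x
    ≡⟨ cong (λ t → β *ℚ c +ℚ x *ℚ t) (eval-addConst (α *ℚ c) (mulLinear α β cs) x) ⟩
  β *ℚ c +ℚ x *ℚ (α *ℚ c +ℚ eval (mulLinear α β cs) x)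
    ≡⟨ cong (λ t → β *ℚ c +ℚ x *ℚ (α *ℚ c +ℚ t)) (eval-mulLinear α β cs x) ⟩
  β *ℚ c +ℚ x *ℚ (α *ℚ c +ℚ (α *ℚ x +ℚ β) *ℚ eval cs x)
    ≡⟨ solve 5 (λ α β c x e → β :* c :+ x :* (α :* c :+ (α :* x :+ β) :* e)
                              := (α :* x :+ β) :* (c :+ x :* e)) refl α β c x (eval cs x) ⟩
  (α *ℚ x +ℚ β) *ℚ (c +ℚ x *ℚ eval cs x) ∎
  where open ℚ-Solver

mulLinear-∷ʳ : ∀ α β cs c → Σ (List ℚ) λ cs′ →
               mulLinear α β (cs ∷ʳ c) ≡ cs′ ∷ʳ α *ℚ c × length cs′ ≡ suc (length cs)
mulLinear-∷ʳ α β []       c = β *ℚ c ∷ [] , refl , refl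
mulLinear-∷ʳ α β (x ∷ xs) c with mulLinear-∷ʳ α β xs c
... | y ∷ ys , eq , len rewrite eq = β *ℚ x ∷ α *ℚ x +ℚ y ∷ ys , refl , cong suc len

mulLinear-degree : ∀ {α} β {p r} → α ≢ 0ℚ → HasDegree p r → HasDegree (mulLinear α β p) (suc r)
mulLinear-degree {α} β α≢0 (cs , c , refl , c≢0 , refl) with mulLinear-∷ʳ α β cs c
... | cs′ , eq , len = cs′ , α *ℚ c , eq , *-≢0 α≢0 c≢0 , len

addConst-degree : ∀ a {p r} → HasDegree p (suc r) → HasDegree (addConst a p) (suc r)
addConst-degree a (y ∷ ys , c , refl , c≢0 , len) = a +ℚ y ∷ ys , c , refl , c≢0 , len

-- Pascal's recurrence and Newton series

∑< : ℕ → (ℕ → ℕ) → ℕ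
∑< zero    f = 0
∑< (suc n) f = f 0 + ∑< n (λ k → f (suc k))

∑<-cong : ∀ n {f g} → (∀ k → f k ≡ g k) → ∑< n f ≡ ∑< n g
∑<-cong zero    f≗g = refl
∑<-cong (suc n) f≗g = cong₂ _+_ (f≗g 0) (∑<-cong n (λ k → f≗g (suc k)))

∑<-zero : ∀ n {f} → (∀ k → f k ≡ 0) → ∑< n f ≡ 0
∑<-zero zero    f≗0 = refl
∑<-zero (suc n) f≗0 = cong₂ _+_ (f≗0 0) (∑<-zero n (λ k → f≗0 (suc k)))

∑<-+ : ∀ n f g → ∑< n (λ k → f k + g k) ≡ ∑< n f + ∑< n g
∑<-+ zero    f g = refl
∑<-+ (suc n) f g = begin
  (f 0 + g 0) + ∑< n (λ k → f (suc k) + g (suc k))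
    ≡⟨ cong ((f 0 + g 0) +_) (∑<-+ n (λ k → f (suc k)) (λ k → g (suc k))) ⟩
  (f 0 + g 0) + (∑< n (λ k → f (suc k)) + ∑< n (λ k → g (suc k)))
    ≡⟨ +-interchange (f 0) (g 0) _ _ ⟩
  (f 0 + ∑< n (λ k → f (suc k))) + (g 0 + ∑< n (λ k → g (suc k))) ∎

∑<-suc : ∀ n f → ∑< (suc n) f ≡ ∑< n f + f n
∑<-suc zero    f = ℕ.+-comm (f 0) 0
∑<-suc (suc n) f = trans (cong (f 0 +_) (∑<-suc n (λ k → f (suc k)))) (sym (ℕ.+-assoc (f 0) _ _))

-- (i + 1) · C(m, i + 1) = (m − i) · C(m, i), with the subtraction moved across
C-absorption : ∀ m i → suc i * (m C suc i) + i * (m C i) ≡ m * (m C i)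
C-absorption zero    zero    = refl
C-absorption zero    (suc i) = cong₂ _+_ (ℕ.*-zeroʳ (suc (suc i))) (ℕ.*-zeroʳ (suc i))
C-absorption (suc m) zero    = begin
  1 * (suc m C 1) + 0 ≡⟨ ℕ.+-identityʳ _ ⟩
  1 * (suc m C 1)     ≡⟨ ℕ.*-identityˡ _ ⟩
  suc m C 1           ≡⟨ nC1≡n (suc m) ⟩
  suc m               ≡⟨ ℕ.*-identityʳ (suc m) ⟨
  suc m * 1           ∎
C-absorption (suc m) (suc i) = begin
  2+i * (suc m C 2+i) + 1+i * (suc m C 1+i)
    ≡⟨ cong₂ (λ s t → 2+i * s + 1+i * t) (nCk+nC[k+1]≡[n+1]C[k+1] m 1+i) (nCk+nC[k+1]≡[n+1]C[k+1] m i) ⟨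
  2+i * (x₁ + x₂) + 1+i * (x₀ + x₁)
    ≡⟨ solve 5 (λ i m x₀ x₁ x₂ → (con 2 :+ i) :* (x₁ :+ x₂) :+ (con 1 :+ i) :* (x₀ :+ x₁)
                              := ((con 2 :+ i) :* x₂ :+ (con 1 :+ i) :* x₁) :+ ((con 1 :+ i) :* x₁ :+ i :* x₀) :+ (x₀ :+ x₁))
              refl i m x₀ x₁ x₂ ⟩
  (2+i * x₂ + 1+i * x₁) + (1+i * x₁ + i * x₀) + (x₀ + x₁)
    ≡⟨ cong₂ (λ s t → s + t + (x₀ + x₁)) (C-absorption m (suc i)) (C-absorption m i) ⟩
  m * x₁ + m * x₀ + (x₀ + x₁)
    ≡⟨ solve 3 (λ m x₀ x₁ → m :* x₁ :+ m :* x₀ :+ (x₀ :+ x₁) := (con 1 :+ m) :* (x₀ :+ x₁)) refl m x₀ x₁ ⟩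
  suc m * (x₀ + x₁)
    ≡⟨ cong (suc m *_) (nCk+nC[k+1]≡[n+1]C[k+1] m i) ⟩
  suc m * (suc m C 1+i) ∎
  where
  open ℕ-Solver
  x₀ x₁ x₂ 1+i 2+i : ℕ
  x₀ = m C i
  x₁ = m C suc i
  x₂ = m C suc (suc i)
  1+i = suc i
  2+i = suc (suc i)

C-absorptionℚ : ∀ m i → ℕ→ℚ (suc i) *ℚ ℕ→ℚ (m C suc i) +ℚ ℕ→ℚ i *ℚ ℕ→ℚ (m C i)
                        ≡ ℕ→ℚ m *ℚ ℕ→ℚ (m C i)
C-absorptionℚ m i = begin
  ℕ→ℚ (suc i) *ℚ ℕ→ℚ (m C suc i) +ℚ ℕ→ℚ i *ℚ ℕ→ℚ (m C i)
    ≡⟨ cong₂ _+ℚ_ (ℕ→ℚ-* (suc i) (m C suc i)) (ℕ→ℚ-* i (m C i)) ⟨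
  ℕ→ℚ (suc i * (m C suc i)) +ℚ ℕ→ℚ (i * (m C i))
    ≡⟨ ℕ→ℚ-+ (suc i * (m C suc i)) (i * (m C i)) ⟨
  ℕ→ℚ (suc i * (m C suc i) + i * (m C i))
    ≡⟨ cong ℕ→ℚ (C-absorption m i) ⟩
  ℕ→ℚ (m * (m C i))
    ≡⟨ ℕ→ℚ-* m (m C i) ⟩
  ℕ→ℚ m *ℚ ℕ→ℚ (m C i) ∎

module PascalRecurrence (E : ℕ → ℕ → ℕ) (d : ℕ)
  (E-pascal : ∀ j m → E j (suc m) ≡ E j m + E (suc j) m)
  (E-vanishes : ∀ j → d < j → E j 0 ≡ 0) where

  E-closed : ∀ m j → E j m ≡ ∑< (suc d) (λ k → (m C k) * E (j + k) 0)
  E-closed zero j = begin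
    E j 0                                     ≡⟨ cong (λ i → E i 0) (ℕ.+-identityʳ j) ⟨
    E (j + 0) 0                               ≡⟨ ℕ.+-identityʳ _ ⟨
    E (j + 0) 0 + 0                           ≡⟨ cong₂ _+_ (ℕ.*-identityˡ _) (∑<-zero d (λ _ → refl)) ⟨
    1 * E (j + 0) 0 + ∑< d (λ _ → 0)          ∎
  E-closed (suc m) j = begin
    E j (suc m)                               ≡⟨ E-pascal j m ⟩
    E j m + E (suc j) m                       ≡⟨ cong₂ _+_ (E-closed m j) (E-closed m (suc j)) ⟩
    (x₀ + ∑< d upper) + ∑< (suc d) lower′     ≡⟨ cong ((x₀ + ∑< d upper) +_) lower-shift ⟩
    (x₀ + ∑< d upper) + ∑< d lower            ≡⟨ ℕ.+-assoc x₀ _ _ ⟩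
    x₀ + (∑< d upper + ∑< d lower)            ≡⟨ cong (x₀ +_) (ℕ.+-comm (∑< d upper) _) ⟩
    x₀ + (∑< d lower + ∑< d upper)            ≡⟨ cong (x₀ +_) (∑<-+ d lower upper) ⟨
    x₀ + ∑< d (λ k → lower k + upper k)       ≡⟨ cong (x₀ +_) (∑<-cong d pascal) ⟩
    x₀ + ∑< d (λ k → (suc m C suc k) * a (j + suc k)) ∎
    where
    a : ℕ → ℕ
    a i = E i 0
    x₀ : ℕ
    x₀ = 1 * a (j + 0)
    upper lower lower′ : ℕ → ℕ
    upper  k = (m C suc k) * a (j + suc k)
    lower  k = (m C k) * a (j + suc k)
    lower′ k = (m C k) * a (suc j + k)
    lower-shift : ∑< (suc d) lower′ ≡ ∑< d lower
    lower-shift = begin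
      ∑< (suc d) lower′                       ≡⟨ ∑<-suc d lower′ ⟩
      ∑< d lower′ + (m C d) * a (suc j + d)
        ≡⟨ cong (λ t → ∑< d lower′ + (m C d) * t) (E-vanishes (suc j + d) (s≤s (ℕ.m≤n+m d j))) ⟩
      ∑< d lower′ + (m C d) * 0               ≡⟨ cong (∑< d lower′ +_) (ℕ.*-zeroʳ (m C d)) ⟩
      ∑< d lower′ + 0                         ≡⟨ ℕ.+-identityʳ _ ⟩
      ∑< d lower′                             ≡⟨ ∑<-cong d (λ k → cong (λ i → (m C k) * a i) (ℕ.+-suc j k)) ⟨
      ∑< d lower                              ∎
    pascal : ∀ k → lower k + upper k ≡ (suc m C suc k) * a (j + suc k)
    pascal k = trans (sym (ℕ.*-distribʳ-+ (a (j + suc k)) (m C k) (m C suc k)))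
                     (cong (_* a (j + suc k)) (nCk+nC[k+1]≡[n+1]C[k+1] m k))

module NewtonSeries (c : ℕ) (a : ℕ → ℕ) where

  -- horner i r = a i + (x − c − i)/(i + 1) · (a (i + 1) + (x − c − i − 1)/(i + 2) · (⋯ a (i + r)))
  horner : ℕ → ℕ → List ℚ
  horner i zero    = ℕ→ℚ (a i) ∷ []
  horner i (suc r) = addConst (ℕ→ℚ (a i)) (mulLinear (recip i) (- (ℕ→ℚ (c + i) *ℚ recip i)) (horner (suc i) r))

  horner-degree : ∀ r i → a (i + r) ≢ 0 → HasDegree (horner i r) r
  horner-degree zero    i aᵢ≢0 =
    [] , ℕ→ℚ (a i) , refl , ℕ→ℚ-≢0 (λ aᵢ≡0 → aᵢ≢0 (trans (cong a (ℕ.+-identityʳ i)) aᵢ≡0)) , refl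
  horner-degree (suc r) i aᵢ₊ᵣ≢0 = addConst-degree _ (mulLinear-degree _ (recip≢0 i)
    (horner-degree r (suc i) λ aᵢ₊ᵣ≡0 → aᵢ₊ᵣ≢0 (trans (cong a (ℕ.+-suc i r)) aᵢ₊ᵣ≡0)))

  -- C(m, i) · (m − i)/(i + 1) = C(m, i + 1)
  binomial-step : ∀ m i → ℕ→ℚ (m C i) *ℚ (recip i *ℚ ℕ→ℚ (m + c) +ℚ - (ℕ→ℚ (c + i) *ℚ recip i))
                          ≡ ℕ→ℚ (m C suc i)
  binomial-step m i = begin
    b *ℚ (R *ℚ ℕ→ℚ (m + c) +ℚ - (ℕ→ℚ (c + i) *ℚ R))
      ≡⟨ cong₂ (λ s t → b *ℚ (R *ℚ s +ℚ - (t *ℚ R))) (ℕ→ℚ-+ m c) (ℕ→ℚ-+ c i) ⟩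
    b *ℚ (R *ℚ (M +ℚ K) +ℚ - ((K +ℚ I) *ℚ R))
      ≡⟨ solve 5 (λ b R M K I → b :* (R :* (M :+ K) :+ :- ((K :+ I) :* R)) := R :* (M :* b :+ :- (I :* b)))
               refl b R M K I ⟩
    R *ℚ (M *ℚ b +ℚ - (I *ℚ b))
      ≡⟨ cong (λ t → R *ℚ (t +ℚ - (I *ℚ b))) (C-absorptionℚ m i) ⟨
    R *ℚ (S *ℚ b′ +ℚ I *ℚ b +ℚ - (I *ℚ b))
      ≡⟨ solve 5 (λ R S I b b′ → R :* (S :* b′ :+ I :* b :+ :- (I :* b)) := (S :* R) :* b′) refl R S I b b′ ⟩
    (S *ℚ R) *ℚ b′
      ≡⟨ cong (_*ℚ b′) (recip-inverse i) ⟩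
    1ℚ *ℚ b′
      ≡⟨ *-identityˡ b′ ⟩
    b′ ∎
    where
    open ℚ-Solver
    b b′ R M K I S : ℚ
    b = ℕ→ℚ (m C i)
    b′ = ℕ→ℚ (m C suc i)
    R = recip i
    M = ℕ→ℚ m
    K = ℕ→ℚ c
    I = ℕ→ℚ i
    S = ℕ→ℚ (suc i)

  eval-horner : ∀ m r i → ℕ→ℚ (m C i) *ℚ eval (horner i r) (ℕ→ℚ (m + c))
                          ≡ ℕ→ℚ (∑< (suc r) (λ k → (m C (i + k)) * a (i + k)))
  eval-horner m zero i = begin
    ℕ→ℚ (m C i) *ℚ (ℕ→ℚ (a i) +ℚ ℕ→ℚ (m + c) *ℚ 0ℚ)
      ≡⟨ cong (λ t → ℕ→ℚ (m C i) *ℚ (ℕ→ℚ (a i) +ℚ t)) (*-zeroʳ (ℕ→ℚ (m + c))) ⟩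
    ℕ→ℚ (m C i) *ℚ (ℕ→ℚ (a i) +ℚ 0ℚ)
      ≡⟨ cong (ℕ→ℚ (m C i) *ℚ_) (+-identityʳ (ℕ→ℚ (a i))) ⟩
    ℕ→ℚ (m C i) *ℚ ℕ→ℚ (a i)
      ≡⟨ ℕ→ℚ-* (m C i) (a i) ⟨
    ℕ→ℚ ((m C i) * a i)
      ≡⟨ cong ℕ→ℚ (trans (sym (ℕ.+-identityʳ _)) (cong (λ j → (m C j) * a j + 0) (sym (ℕ.+-identityʳ i)))) ⟩
    ℕ→ℚ ((m C (i + 0)) * a (i + 0) + 0) ∎
  eval-horner m (suc r) i = begin
    b *ℚ eval (addConst A (mulLinear R β (horner (suc i) r))) X
      ≡⟨ cong (b *ℚ_) (eval-addConst A (mulLinear R β (horner (suc i) r)) X) ⟩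
    b *ℚ (A +ℚ eval (mulLinear R β (horner (suc i) r)) X)
      ≡⟨ cong (λ t → b *ℚ (A +ℚ t)) (eval-mulLinear R β (horner (suc i) r) X) ⟩
    b *ℚ (A +ℚ (R *ℚ X +ℚ β) *ℚ e)
      ≡⟨ solve 4 (λ b A L e → b :* (A :+ L :* e) := b :* A :+ (b :* L) :* e) refl b A (R *ℚ X +ℚ β) e ⟩
    b *ℚ A +ℚ (b *ℚ (R *ℚ X +ℚ β)) *ℚ e
      ≡⟨ cong (λ t → b *ℚ A +ℚ t *ℚ e) (binomial-step m i) ⟩
    b *ℚ A +ℚ ℕ→ℚ (m C suc i) *ℚ e
      ≡⟨ cong₂ _+ℚ_ (sym (ℕ→ℚ-* (m C i) (a i))) (eval-horner m r (suc i)) ⟩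
    ℕ→ℚ ((m C i) * a i) +ℚ ℕ→ℚ (∑< (suc r) (λ k → (m C (suc i + k)) * a (suc i + k)))
      ≡⟨ ℕ→ℚ-+ ((m C i) * a i) _ ⟨
    ℕ→ℚ ((m C i) * a i + ∑< (suc r) (λ k → (m C (suc i + k)) * a (suc i + k)))
      ≡⟨ cong ℕ→ℚ (cong₂ _+_ (cong term (ℕ.+-identityʳ i)) (∑<-cong (suc r) (cong term ∘ ℕ.+-suc i))) ⟨
    ℕ→ℚ (term (i + 0) + ∑< (suc r) (λ k → term (i + suc k))) ∎
    where
    open ℚ-Solver
    X b A R β e : ℚ
    X = ℕ→ℚ (m + c)
    b = ℕ→ℚ (m C i)
    A = ℕ→ℚ (a i)
    R = recip i
    β = - (ℕ→ℚ (c + i) *ℚ R)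
    e = eval (horner (suc i) r) X
    term : ℕ → ℕ
    term j = (m C j) * a j

private variable
  A B : Set

module _ {P Q : A → Set} (P? : Decidable P) (Q? : Decidable Q) where

  filter-∩ : ∀ xs → filter (P? ∩? Q?) xs ≡ filter Q? (filter P? xs)
  filter-∩ [] = refl
  filter-∩ (x ∷ xs) with P? x
  ... | no  _ = filter-∩ xs
  ... | yes _ with Q? x
  ...   | yes _ = cong (x ∷_) (filter-∩ xs)
  ...   | no  _ = filter-∩ xs

filter-map : ∀ {P : A → Set} (P? : Decidable P) (f : B → A) xs → filter P? (map f xs) ≡ map f (filter (P? ∘ f) xs)
filter-map P? f []       = refl
filter-map P? f (x ∷ xs) with P? (f x)
... | yes _ = cong (f x ∷_) (filter-map P? f xs)
... | no  _ = filter-map P? f xs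

module _ {P : A → Set} (P? : Decidable P) where

  length-filter-∁+filter : ∀ xs → length (filter (∁? P?) xs) + length (filter P? xs) ≡ length xs
  length-filter-∁+filter []       = refl
  length-filter-∁+filter (x ∷ xs) with P? x
  ... | yes _ = trans (ℕ.+-suc _ _) (cong suc (length-filter-∁+filter xs))
  ... | no  _ = cong suc (length-filter-∁+filter xs)

  filter-all-tuples : ∀ r xs → filter (all? P?) (tuples r xs) ≡ tuples r (filter P? xs)
  filter-all-tuples zero    xs = refl
  filter-all-tuples (suc r) xs =
    trans (filter-prepend (tuples r xs) xs)
          (cong (λ yss → concatMap (λ x → map (x ∷_) yss) (filter P? xs)) (filter-all-tuples r xs))
    where
    filter-prepend : ∀ yss xs → filter (all? P?) (concatMap (λ x → map (x ∷_) yss) xs)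
                                ≡ concatMap (λ x → map (x ∷_) (filter (all? P?) yss)) (filter P? xs)
    filter-prepend yss []       = refl
    filter-prepend yss (x ∷ xs) with P? x
    ... | yes px = trans (filter-++ (all? P?) (map (x ∷_) yss) _) (cong₂ _++_ accepted (filter-prepend yss xs))
      where
      accepted : filter (all? P?) (map (x ∷_) yss) ≡ map (x ∷_) (filter (all? P?) yss)
      accepted = trans (filter-map (all? P?) (x ∷_) yss) (cong (map (x ∷_)) (filter-≐ _ _ (All.tail , (px ∷_)) yss))
    ... | no ¬px = trans (filter-++ (all? P?) (map (x ∷_) yss) _) (cong₂ _++_ rejected (filter-prepend yss xs))
      where
      rejected : filter (all? P?) (map (x ∷_) yss) ≡ []
      rejected = trans (filter-map (all? P?) (x ∷_) yss)
                       (cong (map (x ∷_)) (filter-none _ (All.universal (λ _ → ¬px ∘ All.head) yss)))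

tuples-map : ∀ {A B : Set} (f : A → B) r xs → tuples r (map f xs) ≡ map (map f) (tuples r xs)
tuples-map f zero    xs = refl
tuples-map {A} f (suc r) xs = begin
  concatMap (λ y → map (y ∷_) (tuples r (map f xs))) (map f xs)
    ≡⟨ cong (λ T → concatMap (λ y → map (y ∷_) T) (map f xs)) (tuples-map f r xs) ⟩
  concatMap (λ y → map (y ∷_) (map (map f) T)) (map f xs)
    ≡⟨ concatMap-map (λ y → map (y ∷_) (map (map f) T)) f xs ⟩
  concatMap (λ x → map (f x ∷_) (map (map f) T)) xs
    ≡⟨ concatMap-cong (λ x → trans (sym (map-∘ T)) (map-∘ T)) xs ⟩
  concatMap (λ x → map (map f) (map (x ∷_) T)) xs
    ≡⟨ map-concatMap (map f) (λ x → map (x ∷_) T) xs ⟨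
  map (map f) (concatMap (λ x → map (x ∷_) T) xs) ∎
  where
  T : List (List A)
  T = tuples r xs

module _ {P : A → Set} {Q : B → Set} (P? : Decidable P) (Q? : Decidable Q) where

  filter-cartesianProduct : ∀ xs ys →
    filter (λ p → P? (proj₁ p) ×-dec Q? (proj₂ p)) (cartesianProduct xs ys) ≡ cartesianProduct (filter P? xs) (filter Q? ys)
  filter-cartesianProduct []       ys = refl
  filter-cartesianProduct (x ∷ xs) ys with P? x
  ... | yes px = trans (filter-++ _ (map (x ,_) ys) _) (cong₂ _++_ row (filter-cartesianProduct xs ys))
    where
    row : filter (λ p → P? (proj₁ p) ×-dec Q? (proj₂ p)) (map (x ,_) ys) ≡ map (x ,_) (filter Q? ys)
    row = trans (filter-map _ (x ,_) ys) (cong (map (x ,_)) (filter-≐ _ Q? (proj₂ , (px ,_)) ys))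
  ... | no ¬px = trans (filter-++ _ (map (x ,_) ys) _) (cong₂ _++_ row (filter-cartesianProduct xs ys))
    where
    row : filter (λ p → P? (proj₁ p) ×-dec Q? (proj₂ p)) (map (x ,_) ys) ≡ []
    row = trans (filter-map _ (x ,_) ys) (cong (map (x ,_)) (filter-none _ (All.universal (λ _ → ¬px ∘ proj₁) ys)))

cartesianProduct-map : ∀ {C D : Set} (f : A → C) (g : B → D) xs ys →
  cartesianProduct (map f xs) (map g ys) ≡ map (Product.map f g) (cartesianProduct xs ys)
cartesianProduct-map f g []       ys = refl
cartesianProduct-map f g (x ∷ xs) ys = begin
  map (f x ,_) (map g ys) ++ cartesianProduct (map f xs) (map g ys)
    ≡⟨ cong₂ _++_ (trans (sym (map-∘ ys)) (map-∘ ys)) (cartesianProduct-map f g xs ys) ⟩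
  map (Product.map f g) (map (x ,_) ys) ++ map (Product.map f g) (cartesianProduct xs ys)
    ≡⟨ map-++ (Product.map f g) (map (x ,_) ys) _ ⟨
  map (Product.map f g) (map (x ,_) ys ++ cartesianProduct xs ys) ∎

tuples-length : ∀ r (xs : List A) → All (λ ys → length ys ≡ r) (tuples r xs)
tuples-length zero    xs = refl ∷ []
tuples-length (suc r) xs = All.concat⁺ (All.map⁺ (All.universal (λ x → All.map⁺ (All.map (cong suc) (tuples-length r xs))) xs))

∈-tuples : ∀ {xs ys : List A} → All (_∈ xs) ys → ys ∈ tuples (length ys) xs
∈-tuples []           = here refl
∈-tuples (y∈xs ∷ ys∈) = ∈-concat⁺′ (∈-map⁺ (_ ∷_) (∈-tuples ys∈)) (∈-map⁺ (λ x → map (x ∷_) _) y∈xs)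

unique-⊆⇒length≤ : ∀ {xs ys : List A} → Unique xs → (∀ {x} → x ∈ xs → x ∈ ys) → length xs ≤ length ys
unique-⊆⇒length≤ {xs = []}     _                xs⊆ys = z≤n
unique-⊆⇒length≤ {xs = x ∷ xs} (x∉xs AllPairs.∷ unique) xs⊆ys with ∈-∃++ (xs⊆ys (here refl))
... | us , vs , refl =
  ℕ.≤-trans (s≤s (unique-⊆⇒length≤ unique xs⊆us++vs)) (ℕ.≤-reflexive (sym (length-++-sucʳ us x vs)))
  where
  xs⊆us++vs : ∀ {y} → y ∈ xs → y ∈ us ++ vs
  xs⊆us++vs {y} y∈xs with ∈-++⁻ us (xs⊆ys (there y∈xs))
  ... | inj₁ y∈us         = ∈-++⁺ˡ y∈us
  ... | inj₂ (here refl)  = contradiction y∈xs (All.All¬⇒¬Any x∉xs)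
  ... | inj₂ (there y∈vs) = ∈-++⁺ʳ us y∈vs

last-∈ : ∀ {xs : List A} {x} → last xs ≡ just x → x ∈ xs
last-∈ {xs = _ ∷ []}    refl = here refl
last-∈ {xs = _ ∷ _ ∷ _} eq   = there (last-∈ eq)

all-map-⇔ : ∀ {P : B → Set} {Q : A → Set} {g : A → B} → (∀ x → P (g x) ⇔ Q x) → ∀ xs → All P (map g xs) ⇔ All Q xs
all-map-⇔ P⇔Q xs = mk⇔ (All.map (λ {x} → Equivalence.to (P⇔Q x)) ∘ All.map⁻)
                       (All.map⁺ ∘ All.map (λ {x} → Equivalence.from (P⇔Q x)))

any-map-⇔ : ∀ {P : B → Set} {Q : A → Set} {g : A → B} → (∀ x → P (g x) ⇔ Q x) → ∀ xs → Any P (map g xs) ⇔ Any Q xs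
any-map-⇔ P⇔Q xs = mk⇔ (Any.map (λ {x} → Equivalence.to (P⇔Q x)) ∘ Any.map⁻)
                       (Any.map⁺ ∘ Any.map (λ {x} → Equivalence.from (P⇔Q x)))

linked-map-⇔ : ∀ {R : B → B → Set} {S : A → A → Set} {g : A → B} → (∀ x y → R (g x) (g y) ⇔ S x y) →
               ∀ xs → Linked R (map g xs) ⇔ Linked S xs
linked-map-⇔ R⇔S xs = mk⇔ (Linked.map (λ {x} {y} → Equivalence.to (R⇔S x y)) ∘ Linked.map⁻)
                          (Linked.map⁺ ∘ Linked.map (λ {x} {y} → Equivalence.from (R⇔S x y)))

-- The grid with one value removed

punchIn : ℕ → ℕ → ℕ
punchIn u k with k <? u
... | yes _ = k
... | no  _ = suc k

punchIn-< : ∀ {u k} → k < u → punchIn u k ≡ k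
punchIn-< {u} {k} k<u with k <? u
... | yes _   = refl
... | no  k≮u = contradiction k<u k≮u

punchIn-≥ : ∀ {u k} → u ≤ k → punchIn u k ≡ suc k
punchIn-≥ {u} {k} u≤k with k <? u
... | yes k<u = contradiction u≤k (ℕ.<⇒≱ k<u)
... | no  _   = refl

punchIn-mono : ∀ u {a b} → a < b → punchIn u a < punchIn u b
punchIn-mono u {a} {b} a<b with a <? u | b <? u
... | yes _   | yes _   = a<b
... | yes _   | no  _   = ℕ.m<n⇒m<1+n a<b
... | no  a≮u | yes b<u = contradiction (ℕ.<-trans a<b b<u) a≮u
... | no  _   | no  _   = s≤s a<b

axis : ℕ → List ℕ
axis n = map suc (upTo n)

axis-∷ʳ : ∀ n → axis (suc n) ≡ axis n ∷ʳ suc n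
axis-∷ʳ n = trans (cong (map suc) (sym (upTo-∷ʳ n))) (map-++ suc (upTo n) (n ∷ []))

axis-≤ : ∀ n → All (_≤ n) (axis n)
axis-≤ n = All.map⁺ (All.tabulate ∈-upTo⁻)

axis-without-last : ∀ n → filter (λ k → ¬? (k ≟ suc n)) (axis (suc n)) ≡ map (punchIn (suc n)) (axis n)
axis-without-last n = begin
  filter ≢u? (axis (suc n))                       ≡⟨ cong (filter ≢u?) (axis-∷ʳ n) ⟩
  filter ≢u? (axis n ∷ʳ suc n)                    ≡⟨ filter-++ ≢u? (axis n) _ ⟩
  filter ≢u? (axis n) ++ filter ≢u? (suc n ∷ [])
    ≡⟨ cong₂ _++_ (filter-all ≢u? (All.map (λ k≤n k≡u → ℕ.<-irrefl k≡u (s≤s k≤n)) (axis-≤ n)))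
                  (filter-reject ≢u? (λ u≢u → u≢u refl)) ⟩
  axis n ++ []                                    ≡⟨ ++-identityʳ (axis n) ⟩
  axis n                                          ≡⟨ map-id-local (All.map (λ k≤n → punchIn-< (s≤s k≤n)) (axis-≤ n)) ⟨
  map (punchIn (suc n)) (axis n)                     ∎
  where
  ≢u? : Decidable (_≢ suc n)
  ≢u? k = ¬? (k ≟ suc n)

axis-without : ∀ {u} n → 1 ≤ u → u ≤ suc n → filter (λ k → ¬? (k ≟ u)) (axis (suc n)) ≡ map (punchIn u) (axis n)
axis-without {suc zero}    zero    _   _        = axis-without-last zero
axis-without {suc (suc _)} zero    _   (s≤s ())
axis-without {u}           (suc n) 1≤u u≤2+n with u ≟ suc (suc n)
... | yes refl = axis-without-last (suc n)
... | no  u≢2+n = begin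
  filter ≢u? (axis (suc (suc n)))                 ≡⟨ cong (filter ≢u?) (axis-∷ʳ (suc n)) ⟩
  filter ≢u? (axis (suc n) ∷ʳ suc (suc n))        ≡⟨ filter-++ ≢u? (axis (suc n)) _ ⟩
  filter ≢u? (axis (suc n)) ++ filter ≢u? (suc (suc n) ∷ [])
    ≡⟨ cong₂ _++_ (axis-without n 1≤u u≤1+n) (filter-accept ≢u? (λ 2+n≡u → u≢2+n (sym 2+n≡u))) ⟩
  map (punchIn u) (axis n) ++ suc (suc n) ∷ []       ≡⟨ cong (λ k → map (punchIn u) (axis n) ++ k ∷ []) (punchIn-≥ u≤1+n) ⟨
  map (punchIn u) (axis n) ++ punchIn u (suc n) ∷ []    ≡⟨ map-++ (punchIn u) (axis n) (suc n ∷ []) ⟨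
  map (punchIn u) (axis n ∷ʳ suc n)                  ≡⟨ cong (map (punchIn u)) (axis-∷ʳ n) ⟨
  map (punchIn u) (axis (suc n))                     ∎
  where
  ≢u? : Decidable (_≢ u)
  ≢u? k = ¬? (k ≟ u)
  u≤1+n : u ≤ suc n
  u≤1+n = ℕ.≤-pred (ℕ.≤∧≢⇒< u≤2+n u≢2+n)

∈-axis : ∀ {n k} → 1 ≤ k → k ≤ n → k ∈ axis n
∈-axis {k = suc i} _ i<n = ∈-map⁺ suc (∈-upTo⁺ i<n)

goodPoint⇒∈grid : ∀ {n p} → GoodPoint n p → p ∈ grid n
goodPoint⇒∈grid ((1≤x , x≤n) , (1≤y , y≤n) , _) = ∈-cartesianProduct⁺ (∈-axis 1≤x x≤n) (∈-axis 1≤y y≤n)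

relabel : (ℕ → ℕ) → Point → Point
relabel f (x , y) = f x , f y

Avoids : ℕ → Point → Set
Avoids u (x , y) = x ≢ u × y ≢ u

avoids? : ∀ u → Decidable (Avoids u)
avoids? u (x , y) = ¬? (x ≟ u) ×-dec ¬? (y ≟ u)

grid-avoiding : ∀ {u} n → 1 ≤ u → u ≤ suc n → filter (avoids? u) (grid (suc n)) ≡ map (relabel (punchIn u)) (grid n)
grid-avoiding {u} n 1≤u u≤1+n = begin
  filter (avoids? u) (grid (suc n))
    ≡⟨ filter-cartesianProduct ≢u? ≢u? (axis (suc n)) (axis (suc n)) ⟩
  cartesianProduct (filter ≢u? (axis (suc n))) (filter ≢u? (axis (suc n)))
    ≡⟨ cong₂ cartesianProduct (axis-without n 1≤u u≤1+n) (axis-without n 1≤u u≤1+n) ⟩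
  cartesianProduct (map (punchIn u) (axis n)) (map (punchIn u) (axis n))
    ≡⟨ cartesianProduct-map (punchIn u) (punchIn u) (axis n) (axis n) ⟩
  map (relabel (punchIn u)) (grid n) ∎
  where
  ≢u? : Decidable (_≢ u)
  ≢u? k = ¬? (k ≟ u)

-- Relabelling the values of a path

enhanced-vertical : ∀ {x₁ y₁ x₂ y₂} → x₁ ≡ x₂ → enhanced (x₁ , y₁) (x₂ , y₂) ≡ (y₁ , y₂ , x₁)
enhanced-vertical {x₁} refl rewrite Equivalence.to T-≡ (ℕ.≡⇒≡ᵇ x₁ x₁ refl) = refl

enhanced-horizontal : ∀ {x₁ y₁ x₂ y₂} → x₁ ≢ x₂ → enhanced (x₁ , y₁) (x₂ , y₂) ≡ (x₁ , x₂ , y₁)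
enhanced-horizontal {x₁} {_} {x₂} x₁≢x₂ with x₁ ≡ᵇ x₂ in eq
... | true  = contradiction (ℕ.≡ᵇ⇒≡ x₁ x₂ (Equivalence.from T-≡ eq)) x₁≢x₂
... | false = refl

HasCoordinate : ℕ → Point → Set
HasCoordinate k (x , y) = x ≡ k ⊎ y ≡ k

Visits : ℕ → List Point → Set
Visits k = Any (HasCoordinate k)

visits? : ∀ k → Decidable (Visits k)
visits? k = any? λ (x , y) → (x ≟ k) ⊎-dec (y ≟ k)

-- every path visits 1 and 2 at its start; VisitsAll j asks for the next j values
VisitsAll : ℕ → List Point → Set
VisitsAll zero    ps = ⊤
VisitsAll (suc j) ps = Visits (3 + j) ps × VisitsAll j ps

visitsAll? : ∀ j → Decidable (VisitsAll j)
visitsAll? zero    ps = yes tt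
visitsAll? (suc j) ps = visits? (3 + j) ps ×-dec visitsAll? j ps

visitsAll-intro : ∀ j {ps} → (∀ {k} → 3 ≤ k → k < 3 + j → Visits k ps) → VisitsAll j ps
visitsAll-intro zero    visits = tt
visitsAll-intro (suc j) visits =
  visits (ℕ.m≤m+n 3 j) (ℕ.n<1+n _) , visitsAll-intro j (λ 3≤k k<3+j → visits 3≤k (ℕ.m<n⇒m<1+n k<3+j))

visitsAll-elim : ∀ j {k ps} → VisitsAll j ps → 3 ≤ k → k < 3 + j → Visits k ps
visitsAll-elim zero    _              3≤k k<3   = contradiction k<3 (ℕ.≤⇒≯ 3≤k)
visitsAll-elim (suc j) {k} (visits , rest) 3≤k k<4+j with k ≟ 3 + j
... | yes refl  = visits
... | no k≢3+j = visitsAll-elim j rest 3≤k (ℕ.≤∧≢⇒< (ℕ.≤-pred k<4+j) k≢3+j)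

¬visits⇔all-avoid : ∀ u ps → (¬ Visits u ps) ⇔ All (Avoids u) ps
¬visits⇔all-avoid u ps = mk⇔
  (λ ¬visits → All.map (λ ¬has → ¬has ∘ inj₁ , ¬has ∘ inj₂) (All.¬Any⇒All¬ ps ¬visits))
  (λ avoid → All.All¬⇒¬Any (All.map (λ (x≢u , y≢u) → [ x≢u , y≢u ]) avoid))

module Relabelling (f : ℕ → ℕ) (f-mono : ∀ {a b} → a < b → f a < f b) where

  <-relabel : ∀ {a b} → f a < f b ⇔ a < b
  <-relabel {a} {b} = mk⇔ reflect f-mono
    where
    reflect : f a < f b → a < b
    reflect fa<fb with ℕ.<-cmp a b
    ... | tri< a<b _ _ = a<b
    ... | tri≈ _ refl _ = contradiction fa<fb (ℕ.<-irrefl refl)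
    ... | tri> _ _ b<a = contradiction fa<fb (ℕ.<-asym (f-mono b<a))

  ≡-relabel : ∀ {a b} → f a ≡ f b ⇔ a ≡ b
  ≡-relabel {a} {b} = mk⇔ reflect (cong f)
    where
    reflect : f a ≡ f b → a ≡ b
    reflect fa≡fb with ℕ.<-cmp a b
    ... | tri< a<b _ _ = contradiction fa≡fb (ℕ.<⇒≢ (f-mono a<b))
    ... | tri≈ _ a≡b _ = a≡b
    ... | tri> _ _ b<a = contradiction (sym fa≡fb) (ℕ.<⇒≢ (f-mono b<a))

  ≤-relabel : ∀ {a b} → f a ≤ f b ⇔ a ≤ b
  ≤-relabel = mk⇔ (λ fa≤fb → ℕ.≮⇒≥ (λ b<a → ℕ.<⇒≱ (f-mono b<a) fa≤fb))
                  (λ a≤b → [ ℕ.<⇒≤ ∘ f-mono , ℕ.≤-reflexive ∘ cong f ]′ (ℕ.m≤n⇒m<n∨m≡n a≤b))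

  relabelStep : EStep → EStep
  relabelStep (a , b , z) = f a , f b , f z

  enhanced-relabel : ∀ p q → enhanced (relabel f p) (relabel f q) ≡ relabelStep (enhanced p q)
  enhanced-relabel (x₁ , _) (x₂ , _) with x₁ ≟ x₂
  ... | yes x₁≡x₂ = trans (enhanced-vertical (cong f x₁≡x₂)) (cong relabelStep (sym (enhanced-vertical x₁≡x₂)))
  ... | no  x₁≢x₂ = trans (enhanced-horizontal (x₁≢x₂ ∘ Equivalence.to ≡-relabel))
                          (cong relabelStep (sym (enhanced-horizontal x₁≢x₂)))

  enhancedSteps-relabel : ∀ ps → enhancedSteps (map (relabel f) ps) ≡ map relabelStep (enhancedSteps ps)
  enhancedSteps-relabel []           = refl
  enhancedSteps-relabel (p ∷ [])     = refl
  enhancedSteps-relabel (p ∷ q ∷ ps) = cong₂ _∷_ (enhanced-relabel p q) (enhancedSteps-relabel (q ∷ ps))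

  allPairs-relabel : ∀ es → AllPairs (map relabelStep es) ⇔ AllPairs es
  allPairs-relabel []       = mk⇔ id id
  allPairs-relabel (s ∷ es) = all-map-⇔ (compatible-relabel s) es ×-⇔ allPairs-relabel es
    where
    compatible-relabel : ∀ s t → Compatible (relabelStep s) (relabelStep t) ⇔ Compatible s t
    compatible-relabel _ _ = →-cong-⇔ <-relabel (≡-relabel ⊎-⇔ ≡-relabel)

  goodPoint-relabel : ∀ {N N′} → f 1 ≡ 1 → f N ≡ N′ → ∀ p → GoodPoint N′ (relabel f p) ⇔ GoodPoint N p
  goodPoint-relabel {N} {N′} f1≡1 fN≡N′ (x , y) = bounds x ×-⇔ bounds y ×-⇔ ¬-cong-⇔ ≡-relabel
    where
    bounds : ∀ x → (1 ≤ f x × f x ≤ N′) ⇔ (1 ≤ x × x ≤ N)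
    bounds x = subst₂ (λ s t → (s ≤ f x × f x ≤ t) ⇔ (1 ≤ x × x ≤ N)) f1≡1 fN≡N′ (≤-relabel ×-⇔ ≤-relabel)

  endpoint-relabel : ∀ {m′ m q q′} → m′ ≡ Maybe.map (relabel f) m → relabel f q ≡ q′ →
                     (m′ ≡ just q′) ⇔ (m ≡ just q)
  endpoint-relabel refl refl = mk⇔ (Maybe.map-injective relabel-injective) (cong (Maybe.map (relabel f)))
    where
    relabel-injective : ∀ {p q} → relabel f p ≡ relabel f q → p ≡ q
    relabel-injective eq = cong₂ _,_ (Equivalence.to ≡-relabel (cong proj₁ eq)) (Equivalence.to ≡-relabel (cong proj₂ eq))

  coherent-relabel : ∀ {N N′} → f 1 ≡ 1 → f 2 ≡ 2 → f (N ∸ 1) ≡ N′ ∸ 1 → f N ≡ N′ →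
                     ∀ ps → IsCoherentLatticePath N′ (map (relabel f) ps) ⇔ IsCoherentLatticePath N ps
  coherent-relabel f1≡1 f2≡2 f[N-1] fN ps =
    (endpoint-relabel (head-map ps) (cong₂ _,_ f2≡2 f1≡1)
      ×-⇔ (endpoint-relabel (last-map _ ps) (cong₂ _,_ f[N-1] fN) ⊎-⇔ endpoint-relabel (last-map _ ps) (cong₂ _,_ fN f[N-1]))
      ×-⇔ all-map-⇔ (goodPoint-relabel f1≡1 fN) ps
      ×-⇔ linked-map-⇔ (λ p q → (≡-relabel ×-⇔ <-relabel) ⊎-⇔ (≡-relabel ×-⇔ <-relabel)) ps)
    ×-⇔ subst (λ es → AllPairs es ⇔ AllPairs (enhancedSteps ps)) (sym (enhancedSteps-relabel ps)) (allPairs-relabel (enhancedSteps ps))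

  visitsAll-relabel : ∀ j → (∀ {k} → k < 3 + j → f k ≡ k) → ∀ ps → VisitsAll j (map (relabel f) ps) ⇔ VisitsAll j ps
  visitsAll-relabel zero    _     ps = mk⇔ id id
  visitsAll-relabel (suc j) fixed ps =
    subst (λ k → Visits k (map (relabel f) ps) ⇔ Visits (3 + j) ps) (fixed (ℕ.n<1+n _)) visits-relabel
    ×-⇔ visitsAll-relabel j (fixed ∘ ℕ.m<n⇒m<1+n) ps
    where
    visits-relabel : Visits (f (3 + j)) (map (relabel f) ps) ⇔ Visits (3 + j) ps
    visits-relabel = any-map-⇔ (λ _ → ≡-relabel ⊎-⇔ ≡-relabel) ps

-- Counting paths by their visited values

CoherentVisiting : ℕ → ℕ → List Point → Set
CoherentVisiting n j ps = IsCoherentLatticePath n ps × VisitsAll j ps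

coherentVisiting? : ∀ n j → Decidable (CoherentVisiting n j)
coherentVisiting? n j ps = isCoherentLatticePath? n ps ×-dec visitsAll? j ps

countVisiting : ℕ → ℕ → ℕ → ℕ
countVisiting ℓ j n = length (filter (coherentVisiting? n j) (tuples ℓ (grid n)))

v≡countVisiting : ∀ n ℓ → v n ℓ ≡ countVisiting ℓ 0 n
v≡countVisiting n ℓ = cong length (filter-≐ _ (coherentVisiting? n 0) ((_, tt) , proj₁) (tuples ℓ (grid n)))

-- Split by whether u = j + 3 is visited: the paths of size n + 1 avoiding u are those of size n
-- with the values ≥ u shifted up.
countVisiting-pascal : ∀ ℓ j n → 3 + j < n →
  countVisiting ℓ j (suc n) ≡ countVisiting ℓ j n + countVisiting ℓ (suc j) (suc n)
countVisiting-pascal ℓ j (suc M) (s≤s u≤M) = begin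
  length (filter CV T₂)
    ≡⟨ length-filter-∁+filter (visits? u) (filter CV T₂) ⟨
  length (filter (∁? (visits? u)) (filter CV T₂))
    + length (filter (visits? u) (filter CV T₂))
    ≡⟨ cong₂ _+_ (trans (cong length avoiding) (length-map _ (filter (coherentVisiting? (1 + M) j) T₁))) (cong length visiting) ⟩
  countVisiting ℓ j (1 + M) + countVisiting ℓ (suc j) (2 + M) ∎
  where
  u : ℕ
  u = 3 + j
  CV : Decidable (CoherentVisiting (2 + M) j)
  CV = coherentVisiting? (2 + M) j
  T₁ T₂ : List (List Point)
  T₁ = tuples ℓ (grid (1 + M))
  T₂ = tuples ℓ (grid (2 + M))
  open Relabelling (punchIn u) (punchIn-mono u)

  visiting : filter (visits? u) (filter CV T₂) ≡ filter (coherentVisiting? (2 + M) (suc j)) T₂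
  visiting = trans (sym (filter-∩ CV (visits? u) T₂))
                   (filter-≐ _ _ ((λ ((c , vs) , vu) → c , vu , vs) , (λ (c , vu , vs) → (c , vs) , vu)) T₂)

  relabel-invariant : ∀ ps → CoherentVisiting (2 + M) j (map (relabel (punchIn u)) ps) ⇔ CoherentVisiting (1 + M) j ps
  relabel-invariant ps =
    coherent-relabel refl refl (punchIn-≥ u≤M) (punchIn-≥ (ℕ.m≤n⇒m≤1+n u≤M)) ps
    ×-⇔ visitsAll-relabel j punchIn-< ps

  avoiding : filter (∁? (visits? u)) (filter CV T₂) ≡ map (map (relabel (punchIn u))) (filter (coherentVisiting? (1 + M) j) T₁)
  avoiding = begin
    filter (∁? (visits? u)) (filter CV T₂)
      ≡⟨ filter-∩ CV (∁? (visits? u)) T₂ ⟨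
    filter (CV ∩? ∁? (visits? u)) T₂
      ≡⟨ filter-≐ _ _ ( (λ (cv , ¬vu) → to (¬visits⇔all-avoid u _) ¬vu , cv)
                      , (λ (av , cv) → cv , from (¬visits⇔all-avoid u _) av)) T₂ ⟩
    filter (all? (avoids? u) ∩? CV) T₂
      ≡⟨ filter-∩ (all? (avoids? u)) CV T₂ ⟩
    filter CV (filter (all? (avoids? u)) T₂)
      ≡⟨ cong (filter CV) (filter-all-tuples (avoids? u) ℓ (grid (2 + M))) ⟩
    filter CV (tuples ℓ (filter (avoids? u) (grid (2 + M))))
      ≡⟨ cong (filter CV ∘ tuples ℓ) (grid-avoiding (1 + M) (s≤s z≤n) (ℕ.m≤n⇒m≤1+n (ℕ.m≤n⇒m≤1+n u≤M))) ⟩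
    filter CV (tuples ℓ (map (relabel (punchIn u)) (grid (1 + M))))
      ≡⟨ cong (filter CV) (tuples-map (relabel (punchIn u)) ℓ (grid (1 + M))) ⟩
    filter CV (map (map (relabel (punchIn u))) T₁)
      ≡⟨ filter-map CV (map (relabel (punchIn u))) T₁ ⟩
    map (map (relabel (punchIn u))) (filter (CV ∘ map (relabel (punchIn u))) T₁)
      ≡⟨ cong (map _) (filter-≐ _ _ ((λ {ps} → to (relabel-invariant ps)) , (λ {ps} → from (relabel-invariant ps))) T₁) ⟩
    map (map (relabel (punchIn u))) (filter (coherentVisiting? (1 + M) j) T₁) ∎
    where open Equivalence

values : List Point → List ℕ
values []           = []
values (p ∷ [])     = proj₁ p ∷ proj₂ p ∷ []
values (p ∷ q ∷ ps) = proj₁ (enhanced p q) ∷ values (q ∷ ps)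

length-values : ∀ ps → length (values ps) ≤ suc (length ps)
length-values []           = z≤n
length-values (p ∷ [])     = ℕ.≤-refl
length-values (p ∷ q ∷ ps) = s≤s (length-values (q ∷ ps))

visits⇒∈values : ∀ {k ps} → Linked Step ps → Visits k ps → k ∈ values ps
visits⇒∈values {ps = _ ∷ []}    _ (here (inj₁ refl)) = here refl
visits⇒∈values {ps = _ ∷ []}    _ (here (inj₂ refl)) = there (here refl)
visits⇒∈values {ps = _ ∷ _ ∷ _} (_ ∷ steps) (there v) = there (visits⇒∈values steps v)
visits⇒∈values {ps = (x₁ , y₁) ∷ (x₂ , y₂) ∷ _} (inj₁ (x₁≡x₂ , _) ∷ steps) (here h)
  rewrite enhanced-vertical {y₁ = y₁} {y₂ = y₂} x₁≡x₂ with h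
... | inj₁ x₁≡k = there (visits⇒∈values steps (here (inj₁ (trans (sym x₁≡x₂) x₁≡k))))
... | inj₂ refl = here refl
visits⇒∈values {ps = (x₁ , y₁) ∷ (x₂ , y₂) ∷ _} (inj₂ (y₁≡y₂ , x₁<x₂) ∷ steps) (here h)
  rewrite enhanced-horizontal {y₁ = y₁} {y₂ = y₂} (ℕ.<⇒≢ x₁<x₂) with h
... | inj₁ refl = here refl
... | inj₂ y₁≡k = there (visits⇒∈values steps (here (inj₂ (trans (sym y₁≡y₂) y₁≡k))))

visits-axis⇒length : ∀ {n ps} → Linked Step ps → (∀ {k} → k ∈ axis n → Visits k ps) → n ≤ suc (length ps)
visits-axis⇒length {n} {ps} steps visits = subst (_≤ suc (length ps)) length-axis
  (ℕ.≤-trans (unique-⊆⇒length≤ (Unique.map⁺ ℕ.suc-injective (Unique.upTo⁺ n)) (visits⇒∈values steps ∘ visits))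
             (length-values ps))
  where
  length-axis : length (axis n) ≡ n
  length-axis = trans (length-map suc (upTo n)) (length-upTo n)

-- besides 3, …, j + 2, such a path visits 1 and 2 at its start and j + 3 and j + 4 at its end
coherentVisiting⇒visits-axis : ∀ j {ps} → CoherentVisiting (4 + j) j ps → ∀ {k} → k ∈ axis (4 + j) → Visits k ps
coherentVisiting⇒visits-axis j {(2 , 1) ∷ rest} (((refl , end , _) , _) , visitsAll) k∈axis with ∈-map⁻ suc k∈axis
... | 0 , _ , refl = here (inj₂ refl)
... | 1 , _ , refl = here (inj₁ refl)
... | suc (suc i) , i∈upTo , refl with i <? j | i ≟ j
...   | yes i<j | _        = visitsAll-elim j visitsAll (s≤s (s≤s (s≤s z≤n))) (s≤s (s≤s (s≤s i<j)))
...   | no _    | yes refl = [ (λ e → lose (last-∈ e) (inj₁ refl)) , (λ e → lose (last-∈ e) (inj₂ refl)) ]′ end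
...   | no i≮j  | no i≢j   = subst (λ k → Visits k ((2 , 1) ∷ rest)) (cong (3 +_) i≡1+j)
                              ([ (λ e → lose (last-∈ e) (inj₂ refl)) , (λ e → lose (last-∈ e) (inj₁ refl)) ]′ end)
  where
  i≡1+j : suc j ≡ i
  i≡1+j = ℕ.≤-antisym (ℕ.≤∧≢⇒< (ℕ.≮⇒≥ i≮j) (i≢j ∘ sym))
                      (ℕ.≤-pred (ℕ.≤-pred (ℕ.≤-pred (∈-upTo⁻ i∈upTo))))

countVisiting-vanishes : ∀ ℓ j → ℓ < 3 + j → countVisiting ℓ j (4 + j) ≡ 0
countVisiting-vanishes ℓ j ℓ<3+j =
  cong length (filter-none (coherentVisiting? (4 + j) j) (All.map too-short (tuples-length ℓ (grid (4 + j)))))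
  where
  too-short : ∀ {ps} → length ps ≡ ℓ → ¬ CoherentVisiting (4 + j) j ps
  too-short refl cv@(((_ , _ , _ , steps) , _) , _) =
    ℕ.<⇒≱ ℓ<3+j (ℕ.≤-pred (visits-axis⇒length steps (coherentVisiting⇒visits-axis j cv)))

rowThenUp : ℕ → ℕ → ℕ → List Point
rowThenUp a zero    y = (a , y) ∷ []
rowThenUp a (suc k) y = (suc a , 1) ∷ rowThenUp (suc a) k y

module _ (y : ℕ) where

  length-rowThenUp : ∀ a k → length (rowThenUp a k y) ≡ suc k
  length-rowThenUp a zero    = refl
  length-rowThenUp a (suc k) = cong suc (length-rowThenUp (suc a) k)

  last-rowThenUp : ∀ a k → last ((a , 1) ∷ rowThenUp a k y) ≡ just (a + k , y)
  last-rowThenUp a zero    = cong (λ x → just (x , y)) (sym (ℕ.+-identityʳ a))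
  last-rowThenUp a (suc k) = trans (last-rowThenUp (suc a) k) (cong (λ x → just (x , y)) (sym (ℕ.+-suc a k)))

  ∈-rowThenUp : ∀ {a i} k → a ≤ i → i ≤ a + k → (i , 1) ∈ (a , 1) ∷ rowThenUp a k y
  ∈-rowThenUp {a} {i} k a≤i i≤a+k with a ≟ i
  ... | yes refl = here refl
  ∈-rowThenUp {a} {i} zero    a≤i i≤a+0 | no a≢i =
    contradiction (ℕ.≤-antisym a≤i (subst (i ≤_) (ℕ.+-identityʳ a) i≤a+0)) a≢i
  ∈-rowThenUp {a} {i} (suc k) a≤i i≤a+k | no a≢i =
    there (∈-rowThenUp k (ℕ.≤∧≢⇒< a≤i a≢i) (subst (i ≤_) (ℕ.+-suc a k) i≤a+k))

  all-rowThenUp : ∀ {P : Point → Set} a k → (∀ {i} → a ≤ i → i ≤ a + k → P (i , 1)) → P (a + k , y) →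
                  All P ((a , 1) ∷ rowThenUp a k y)
  all-rowThenUp {P} a zero    row up = row ℕ.≤-refl (ℕ.m≤m+n a 0) ∷ subst (λ x → P (x , y)) (ℕ.+-identityʳ a) up ∷ []
  all-rowThenUp {P} a (suc k) row up = row ℕ.≤-refl (ℕ.m≤m+n a (suc k)) ∷
    all-rowThenUp (suc a) k (λ {i} a<i i≤1+a+k → row (ℕ.<⇒≤ a<i) (subst (i ≤_) (sym (ℕ.+-suc a k)) i≤1+a+k))
                            (subst (λ x → P (x , y)) (ℕ.+-suc a k) up)

  linked-rowThenUp : 1 < y → ∀ a k → Linked Step ((a , 1) ∷ rowThenUp a k y)
  linked-rowThenUp 1<y a zero    = inj₁ (refl , 1<y) ∷ [-]
  linked-rowThenUp 1<y a (suc k) = inj₂ (refl , ℕ.n<1+n a) ∷ linked-rowThenUp 1<y (suc a) k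

  steps-rowThenUp : ∀ a k → All (λ s → a ≤ proj₁ s ⊎ proj₁ s ≡ 1) (enhancedSteps ((a , 1) ∷ rowThenUp a k y))
  steps-rowThenUp a zero    rewrite enhanced-vertical {a} {1} {a} {y} refl = inj₂ refl ∷ []
  steps-rowThenUp a (suc k) rewrite enhanced-horizontal {a} {1} {suc a} {1} (ℕ.<⇒≢ (ℕ.n<1+n a)) =
    inj₁ ℕ.≤-refl ∷ All.map [ inj₁ ∘ ℕ.<⇒≤ , inj₂ ]′ (steps-rowThenUp (suc a) k)

  allPairs-rowThenUp : ∀ a k → AllPairs (enhancedSteps ((a , 1) ∷ rowThenUp a k y))
  allPairs-rowThenUp a zero    = [] , tt
  allPairs-rowThenUp a (suc k) rewrite enhanced-horizontal {a} {1} {suc a} {1} (ℕ.<⇒≢ (ℕ.n<1+n a)) =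
    All.map (λ { (inj₁ a<x) x<1+a → contradiction a<x (ℕ.≤⇒≯ (ℕ.≤-pred x<1+a)) ; (inj₂ x≡1) _ → inj₂ x≡1 })
            (steps-rowThenUp (suc a) k)
    , allPairs-rowThenUp (suc a) k

hookPath : ℕ → List Point
hookPath d = (2 , 1) ∷ rowThenUp 2 (1 + d) (4 + d)

hookPath-good : ∀ d → All (GoodPoint (4 + d)) (hookPath d)
hookPath-good d = all-rowThenUp (4 + d) 2 (1 + d)
  (λ 2≤i i≤3+d → (ℕ.<⇒≤ 2≤i , ℕ.m≤n⇒m≤1+n i≤3+d) , (s≤s z≤n , s≤s z≤n) , λ i≡1 → ℕ.<⇒≢ 2≤i (sym i≡1))
  ((s≤s z≤n , ℕ.n≤1+n _) , (s≤s z≤n , ℕ.≤-refl) , ℕ.<⇒≢ (ℕ.n<1+n _))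

hookPath-coherentVisiting : ∀ d → CoherentVisiting (4 + d) d (hookPath d)
hookPath-coherentVisiting d =
  ( ( refl
    , inj₁ (last-rowThenUp (4 + d) 2 (1 + d))
    , hookPath-good d
    , linked-rowThenUp (4 + d) (s≤s (s≤s z≤n)) 2 (1 + d))
  , allPairs-rowThenUp (4 + d) 2 (1 + d))
  , visitsAll-intro d (λ 3≤k k<3+d → lose (∈-rowThenUp (4 + d) (1 + d) (ℕ.<⇒≤ 3≤k) (ℕ.<⇒≤ k<3+d)) (inj₁ refl))

countVisiting-positive : ∀ d → 0 < countVisiting (3 + d) d (4 + d)
countVisiting-positive d = filter-some (coherentVisiting? (4 + d) d) (lose hookPath∈tuples (hookPath-coherentVisiting d))
  where
  hookPath∈tuples : hookPath d ∈ tuples (3 + d) (grid (4 + d))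
  hookPath∈tuples = subst (λ r → hookPath d ∈ tuples r (grid (4 + d))) (cong suc (length-rowThenUp (4 + d) 2 (1 + d)))
                          (∈-tuples (All.map goodPoint⇒∈grid (hookPath-good d)))

countFrom : ℕ → ℕ → ℕ → ℕ
countFrom ℓ j m = countVisiting ℓ j (m + (4 + j))

countFrom-pascal : ∀ ℓ j m → countFrom ℓ j (suc m) ≡ countFrom ℓ j m + countFrom ℓ (suc j) m
countFrom-pascal ℓ j m = trans (countVisiting-pascal ℓ j (m + (4 + j)) (ℕ.m≤n+m (4 + j) m))
                               (cong (λ n → countFrom ℓ j m + countVisiting ℓ (suc j) n) (sym (ℕ.+-suc m (4 + j))))

countFrom-vanishes : ∀ ℓ j → ℓ ∸ 3 < j → countFrom ℓ j 0 ≡ 0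
countFrom-vanishes ℓ j ℓ∸3<j = countVisiting-vanishes ℓ j (ℕ.≤-<-trans (ℕ.m≤n+m∸n ℓ 3) (ℕ.+-monoʳ-< 3 ℓ∸3<j))

theorem5p7 : (ℓ : ℕ) → 3 ≤ ℓ →
    Σ (List ℚ) λ p → HasDegree p (ℓ ∸ 3) ×
      ((n : ℕ) → 4 ⊔ ⌈ 2 * ℓ + 3 /3⌉ ≤ n → ℕ→ℚ (v n ℓ) ≡ eval p (ℕ→ℚ n))
theorem5p7 ℓ 3≤ℓ = horner 0 d , horner-degree d 0 (ℕ.>⇒≢ positive) , agrees
  where
  d : ℕ
  d = ℓ ∸ 3
  open PascalRecurrence (countFrom ℓ) d (countFrom-pascal ℓ) (countFrom-vanishes ℓ)
  open NewtonSeries 4 (λ j → countFrom ℓ j 0)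
  positive : 0 < countFrom ℓ d 0
  positive = subst (λ ℓ′ → 0 < countVisiting ℓ′ d (4 + d)) (ℕ.m+[n∸m]≡n 3≤ℓ) (countVisiting-positive d)
  agrees : ∀ n → 4 ⊔ ⌈ 2 * ℓ + 3 /3⌉ ≤ n → ℕ→ℚ (v n ℓ) ≡ eval (horner 0 d) (ℕ→ℚ n)
  agrees n bound = subst (λ n → ℕ→ℚ (v n ℓ) ≡ eval (horner 0 d) (ℕ→ℚ n))
                         (ℕ.m∸n+n≡m (ℕ.m⊔n≤o⇒m≤o 4 ⌈ 2 * ℓ + 3 /3⌉ bound)) (agrees-from-4 (n ∸ 4))
    where
    agrees-from-4 : ∀ m → ℕ→ℚ (v (m + 4) ℓ) ≡ eval (horner 0 d) (ℕ→ℚ (m + 4))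
    agrees-from-4 m = begin
      ℕ→ℚ (v (m + 4) ℓ)                                ≡⟨ cong ℕ→ℚ (trans (v≡countVisiting (m + 4) ℓ) (E-closed m 0)) ⟩
      ℕ→ℚ (∑< (suc d) (λ k → (m C k) * countFrom ℓ k 0)) ≡⟨ eval-horner m d 0 ⟨
      1ℚ *ℚ eval (horner 0 d) (ℕ→ℚ (m + 4))             ≡⟨ *-identityˡ _ ⟩
      eval (horner 0 d) (ℕ→ℚ (m + 4))                   ∎
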